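{- Let $\bigl(A, (\mathbb{U}_a,\mathcal{U}_a)_{a\in A}, (\Omega,\mathcal{F}), (\mathcal{I}_a)_{a\in A}\bigr)$ be a W-model, let $H\subset\mathbb{H}$ and $W\subset A$. Then there exists a topology on the set $A$ of agents such that, for every subset $B\subset A$, the topological closure $\overline{B}$ of $B$ in this topology equals the foreset $\mathcal{P}^{*}_{W,H}B$ of the conditional ancestral relation: $$\overline{B}=\mathcal{P}^{*}_{W,H}B.$$ Moreover, in this topology the subset $W$ is open (equivalently, $A\setminus W$ is closed).
   Context: A W-model consists of: a finite set $A$ (agents); for each $a\in A$ a set $\mathbb{U}_a$ with a $\sigma$-field $\mathcal{U}_a$; a set $\Omega$ with a $\sigma$-field $\mathcal{F}$; and for each $a\in A$ a $\sigma$-field $\mathcal{I}_a\subset\mathcal{H}$ (information field), where $\mathbb{H}=\Omega\times\prod_{a\in A}\mathbb{U}_a$ and $\mathcal{H}=\mathcal{F}\otimes\bigotimes_{a\in A}\mathcal{U}_a$. For $B\subset A$, $\mathcal{H}_B=\mathcal{F}\otimes\bigotimes_{b\in B}\mathcal{U}_b\otimes\bigotimes_{c\notin B}\{\emptyset,\mathbb{U}_c\}$. For a $\sigma$-field $\mathcal{G}$ on $\mathbb{H}$ and $H\subset\mathbb{H}$, $\mathcal{G}\cap H=\{G\cap H:G\in\mathcal{G}\}$. The conditional parental relation $\mathcal{P}_{W,H}$ on $A$ is defined by $b\,\mathcal{P}_{W,H}\,a\iff b\in\mathcal{P}_{W,H}\,a$, where $\mathcal{P}_{W,H}\,a=\bigcap\{B\subset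 A:\ \mathcal{I}_a\cap H\subset\mathcal{H}_{B\cup W}\cap H\}$. Composition of relations: $a\,(RR')\,b\iff\exists\delta$, $a\,R\,\delta$ and $\delta\,R'\,b$; $R^{k+1}=RR^k$. The conditional ancestral relation is $\mathcal{P}^{*}_{W,H}=\Delta\cup\bigcup_{k\ge1}\mathcal{P}_{W,H}^k$ with $\Delta=\{(a,a):a\in A\}$ (reflexive–transitive closure). For a relation $R$ and $B\subset A$, the foreset is $R\,B=\{a\in A:\exists b\in B,\ a\,R\,b\}$. -}

module Defs where

open import Level using (Level; 0ℓ; Lift) renaming (suc to lsuc)
open import Data.Nat using (ℕ)
open import Data.Fin using (Fin)
open import Data.Fin.Subset using (Subset; _∈_; _∪_; _∩_; _⊆_; ∁; ⊥; ⊤)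
open import Data.Product using (Σ; ∃; _×_; _,_)
open import Data.Sum using (_⊎_)
open import Data.Unit using () renaming (⊤ to Unit)
open import Data.Empty using () renaming (⊥ to Empty)
open import Relation.Nullary using (¬_)
open import Relation.Binary.Construct.Closure.ReflexiveTransitive using (Star)

PSet : Set → Set₁
PSet X = X → Set

Family : Set → Set₂
Family X = PSet X → Set₁

_≐_ : {X : Set} → PSet X → PSet X → Set
_≐_ {X} S T = (x : X) → (S x → T x) × (T x → S x)

fullP : {X : Set} → PSet X
fullP _ = Unit

emptyP : {X : Set} → PSet X
emptyP _ = Empty

complP : {X : Set} → PSet X → PSet X
complP S x = ¬ S x

⋃ℕ : {X : Set} → (ℕ → PSet X) → PSet X
⋃ℕ f x = ∃ λ i → f i x

-- σ-field on X (subsets represented as predicates, so we also require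
-- closure under extensional equality of subsets)
record IsSigmaField {X : Set} (𝒢 : Family X) : Set₁ where
  field
    resp    : ∀ {S T} → S ≐ T → 𝒢 S → 𝒢 T
    full    : 𝒢 fullP
    compl   : ∀ {S} → 𝒢 S → 𝒢 (complP S)
    cunion  : (f : ℕ → PSet X) → (∀ i → 𝒢 (f i)) → 𝒢 (⋃ℕ f)

data Gen {X : Set} (𝒢 : Family X) : PSet X → Set₁ where
  base   : ∀ {S} → 𝒢 S → Gen 𝒢 S
  resp   : ∀ {S T} → S ≐ T → Gen 𝒢 S → Gen 𝒢 T
  full   : Gen 𝒢 fullP
  compl  : ∀ {S} → Gen 𝒢 S → Gen 𝒢 (complP S)
  cunion : (f : ℕ → PSet X) → (∀ i → Gen 𝒢 (f i)) → Gen 𝒢 (⋃ℕ f)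

record Spaces : Set₂ where
  field
    n     : ℕ
    𝕌     : Fin n → Set
    𝒰     : (a : Fin n) → Family (𝕌 a)
    𝒰-σ   : (a : Fin n) → IsSigmaField (𝒰 a)
    Ω     : Set
    ℱ     : Family Ω
    ℱ-σ   : IsSigmaField ℱ

open Spaces public

ℍ : Spaces → Set
ℍ S = Σ (Ω S) λ _ → ((a : Fin (n S)) → 𝕌 S a)

rect : (Sp : Spaces) → PSet (Ω Sp) → ((a : Fin (n Sp)) → PSet (𝕌 Sp a)) → PSet (ℍ Sp)
rect Sp F S (ω , u) = F ω × ((a : Fin (n Sp)) → S a (u a))

-- measurable rectangles of ℱ ⊗ ⨂_{b∈B} 𝒰_b ⊗ ⨂_{c∉B} {∅,𝕌_c}
Rect : (Sp : Spaces) → Subset (n Sp) → Family (ℍ Sp)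
Rect Sp B G = Σ (PSet (Ω Sp)) λ F → Σ ((a : Fin (n Sp)) → PSet (𝕌 Sp a)) λ S →
    ℱ Sp F
  × ((a : Fin (n Sp)) → (a ∈ B × 𝒰 Sp a (S a)) ⊎ (S a ≐ fullP) ⊎ (S a ≐ emptyP))
  × (G ≐ rect Sp F S)

ℋ : (Sp : Spaces) → Subset (n Sp) → Family (ℍ Sp)
ℋ Sp B = Gen (Rect Sp B)

record WModel : Set₂ where
  field
    sp    : Spaces
    𝓘     : Fin (n sp) → Family (ℍ sp)
    𝓘-σ   : (a : Fin (n sp)) → IsSigmaField (𝓘 a)
    𝓘⊆ℋ  : (a : Fin (n sp)) → ∀ G → 𝓘 a G → ℋ sp ⊤ G

open WModel public

module _ (M : WModel) where
  private
    N = n (sp M)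
    HH = ℍ (sp M)

  TraceIncl : PSet HH → Fin N → Subset N → Set₁
  TraceIncl H a B = ∀ G → 𝓘 M a G →
    Σ (PSet HH) λ G' → ℋ (sp M) B G' ×
      ((h : HH) → H h → (G h → G' h) × (G' h → G h))

  Parent : PSet HH → Subset N → Fin N → Fin N → Set₁
  Parent H W b a = (B : Subset N) → TraceIncl H a (B ∪ W) → b ∈ B

  Ancestor : PSet HH → Subset N → Fin N → Fin N → Set₁
  Ancestor H W = Star (Parent H W)

ASet : ℕ → Set₂
ASet N = Fin N → Set₁

_⊆ₚ_ : {N : ℕ} → ASet N → ASet N → Set₁
B ⊆ₚ C = ∀ x → B x → C x

Foreset : {N : ℕ} → (Fin N → Fin N → Set₁) → ASet N → ASet N
Foreset R B a = ∃ λ b → B b × R a b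

record IsTopologyClosed {N : ℕ} (Closed : ASet N → Set₂) : Set₃ where
  field
    closed-∅ : Closed (λ _ → Lift _ Empty)
    closed-A : Closed (λ _ → Lift _ Unit)
    closed-∪ : ∀ {C D} → Closed C → Closed D → Closed (λ x → C x ⊎ D x)
    closed-⋂ : (I : Set₁) (C : I → ASet N) → (∀ i → Closed (C i)) →
               Closed (λ x → ∀ i → C i x)

IsOpen : {N : ℕ} → (ASet N → Set₂) → ASet N → Set₂
IsOpen Closed U = Closed (λ x → ¬ U x)

Closure : {N : ℕ} → (ASet N → Set₂) → ASet N → Fin N → Set₂
Closure {N} Closed B x = (C : ASet N) → Closed C → B ⊆ₚ C → C x

toASet : {N : ℕ} → Subset N → ASet N
toASet W x = Lift _ (x ∈ W)

{-# OPTIONS --safe #-}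
-- Take as closed sets the subsets of agents closed under taking parents (the
-- Alexandrov topology of 𝒫_{W,H}). These are closed under arbitrary unions and
-- intersections, and the smallest one containing B is its set of ancestors
-- 𝒫*_{W,H} B. Every parent lies outside W, because 𝓘_a ⊆ ℋ_A = ℋ_{∁W ∪ W}
-- makes ∁W one of the sets intersected in 𝒫_{W,H} a; hence ∁W is closed.
module Submission where

open import Defs
open import Level using (Lift; lift; lower)
open import Data.Nat using (ℕ)
open import Data.Fin using (Fin)
open import Data.Fin.Subset using (Subset; _∈_; _∉_; ∁; ⊤)
open import Data.Fin.Subset.Properties using (x∈∁p⇒x∉p; ∪-inverseˡ)
open import Data.Product using (Σ; _×_; _,_)
open import Data.Sum using (inj₁; inj₂)
open import Function using (id)
open import Relation.Binary.PropositionalEquality using (subst; sym)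
open import Relation.Binary.Construct.Closure.ReflexiveTransitive using (Star; ε; _◅_)

module _ {N : ℕ} (R : Fin N → Fin N → Set₁) where

  DownClosed : ASet N → Set₂
  DownClosed C = Lift _ (∀ {x y} → R x y → C y → C x)

  downClosed-isTopology : IsTopologyClosed DownClosed
  downClosed-isTopology = record
    { closed-∅ = lift λ _ c → c
    ; closed-A = lift λ _ c → c
    ; closed-∪ = λ (lift C↓) (lift D↓) → lift λ where
        r (inj₁ c) → inj₁ (C↓ r c)
        r (inj₂ d) → inj₂ (D↓ r d)
    ; closed-⋂ = λ _ _ C↓ → lift λ r c i → lower (C↓ i) r (c i)
    }

  foreset-star-downClosed : (B : ASet N) → DownClosed (Foreset (Star R) B)
  foreset-star-downClosed B = lift λ { r (b , b∈B , s) → b , b∈B , r ◅ s }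

  ⊆-foreset-star : (B : ASet N) → B ⊆ₚ Foreset (Star R) B
  ⊆-foreset-star B b b∈B = b , b∈B , ε

  foreset-star-least : {B C : ASet N} → DownClosed C → B ⊆ₚ C → Foreset (Star R) B ⊆ₚ C
  foreset-star-least C↓ B⊆C _ (b , b∈B , ε)     = B⊆C b b∈B
  foreset-star-least C↓ B⊆C _ (b , b∈B , r ◅ s) =
    lower C↓ r (foreset-star-least C↓ B⊆C _ (b , b∈B , s))

  closure⇒foreset-star : (B : ASet N) (x : Fin N) →
    Closure DownClosed B x → Foreset (Star R) B x
  closure⇒foreset-star B x x∈B̄ =
    x∈B̄ (Foreset (Star R) B) (foreset-star-downClosed B) (⊆-foreset-star B)

  foreset-star⇒closure : (B : ASet N) (x : Fin N) →
    Foreset (Star R) B x → Closure DownClosed B x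
  foreset-star⇒closure B x x∈R*B C C↓ B⊆C = foreset-star-least C↓ B⊆C x x∈R*B

module _ (M : WModel) (H : PSet (ℍ (sp M))) where

  traceIncl-⊤ : (a : Fin (n (sp M))) → TraceIncl M H a ⊤
  traceIncl-⊤ a G G∈𝓘 = G , 𝓘⊆ℋ M a G G∈𝓘 , λ _ _ → id , id

  parent∉W : (W : Subset (n (sp M))) {b a : Fin (n (sp M))} → Parent M H W b a → b ∉ W
  parent∉W W {a = a} b𝒫a =
    x∈∁p⇒x∉p (b𝒫a (∁ W) (subst (TraceIncl M H a) (sym (∪-inverseˡ W)) (traceIncl-⊤ a)))

proposition2 : (M : WModel) (H : PSet (ℍ (sp M))) (W : Subset (n (sp M))) →
    Σ (ASet (n (sp M)) → Set₂) λ Closed →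
      IsTopologyClosed Closed
      × ((B : ASet (n (sp M))) (x : Fin (n (sp M))) →
           (Closure Closed B x → Foreset (Ancestor M H W) B x)
         × (Foreset (Ancestor M H W) B x → Closure Closed B x))
      × IsOpen Closed (toASet W)
proposition2 M H W =
    DownClosed 𝒫
  , downClosed-isTopology 𝒫
  , (λ B x → closure⇒foreset-star 𝒫 B x , foreset-star⇒closure 𝒫 B x)
  , lift λ b𝒫a _ b∈W → parent∉W M H W b𝒫a (lower b∈W)
  where
  𝒫 : Fin (n (sp M)) → Fin (n (sp M)) → Set₁
  𝒫 = Parent M H W
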